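{- Let $p\ge 3$, $n\ge 0$ be integers and $\{u,v\}$ an edge of $H_p^n$. Then $|\deg(u)-\deg(v)|\in\{0,\;p-\max\{o(u),o(v)\}\}$.
   Context: For integers $p\ge 3$, $n\ge 0$, let $[p]_0=\{0,\dots,p-1\}$. The generalized Hanoi graph $H_p^n$ has vertex set $[p]_0^n$: a vertex $s=s_n\cdots s_1$ encodes a state of the Tower of Hanoi with $p$ pegs and $n$ discs of sizes $1<\dots<n$, disc $d$ lying on peg $s_d$. Two vertices are adjacent iff they have the form $\underline{s}\,i\,\overline{s}$ and $\underline{s}\,j\,\overline{s}$ with $i\ne j$, $\underline{s}\in[p]_0^{n-d}$, $\overline{s}\in([p]_0\setminus\{i,j\})^{d-1}$ for some $d$. The occupancy $o(s)$ is the number of pegs holding at least one disc in state $s$. -}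

module Defs where

open import Data.Nat using (ℕ; zero; suc)
open import Data.Fin using (Fin)
open import Data.Fin.Properties using (_≟_)
open import Data.Vec using (Vec; []; _∷_)
open import Data.Vec.Properties using (≡-dec)
open import Data.Vec.Relation.Unary.All using (All; all?)
open import Data.Vec.Membership.Propositional using (_∈_)
import Data.Vec.Membership.DecPropositional as VecMem
open import Data.List using (List; []; _∷_; map; concatMap; filter; length; allFin)
open import Data.Product using (_×_)
open import Data.Sum using (_⊎_)
open import Data.Empty using (⊥)
open import Relation.Nullary using (¬_; Dec)
open import Relation.Nullary.Decidable using (_×-dec_; _⊎-dec_; ¬?)
open import Relation.Binary.PropositionalEquality using (_≡_)

-- A state / vertex of H_p^n: a vector s = s_n ⋯ s_1 of pegs.
-- Convention: the HEAD of the vector is s_n (largest disc), the last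
-- entry is s_1 (smallest disc).
State : ℕ → ℕ → Set
State p n = Vec (Fin p) n

-- Adjacency in H_p^n: s = s̲ i s̄, t = s̲ j s̄ with i ≢ j and every
-- entry of s̄ different from i and j.  Unfolded by recursion on the
-- common prefix s̲: either the first (largest-disc) entries agree and
-- the rest is adjacent, or they differ (this is the position i/j) and
-- the remainders coincide (s̄) and avoid both i and j.
Adj : ∀ {p n} → State p n → State p n → Set
Adj [] [] = ⊥
Adj (a ∷ s) (b ∷ t) =
  (a ≡ b × Adj s t) ⊎ (¬ a ≡ b × s ≡ t × All (λ x → ¬ x ≡ a × ¬ x ≡ b) s)

adj? : ∀ {p n} (s t : State p n) → Dec (Adj s t)
adj? [] [] = Relation.Nullary.no (λ ())
adj? (a ∷ s) (b ∷ t) =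
  ((a ≟ b) ×-dec adj? s t)
  ⊎-dec (¬? (a ≟ b) ×-dec ≡-dec _≟_ s t
         ×-dec all? (λ x → ¬? (x ≟ a) ×-dec ¬? (x ≟ b)) s)

allStates : ∀ p n → List (State p n)
allStates p zero = [] ∷ []
allStates p (suc n) = concatMap (λ a → map (a ∷_) (allStates p n)) (allFin p)

deg : ∀ {p n} → State p n → ℕ
deg {p} {n} s = length (filter (adj? s) (allStates p n))

occ : ∀ {p n} → State p n → ℕ
occ {p} s = length (filter (λ k → k ∈? s) (allFin p))
  where open VecMem (_≟_ {p}) using (_∈?_)

-- The degree of a state depends only on its occupancy o: the top discs of the
-- o occupied pegs, taken in increasing size, can move to p − 1, p − 2, …, p − o
-- pegs respectively, so deg s = Σ_{k ≤ o(s)} (p − k).  Along an edge only one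
-- disc changes peg, so the occupancies of the endpoints differ by at most one,
-- and the degrees differ either by 0 or by the last summand p − max(o(u), o(v)).
module Submission where

open import Defs
open import Level using (Level)
open import Data.Nat using (ℕ; zero; suc; _+_; _*_; _≤_; _∸_; _⊔_; ∣_-_∣)
open import Data.Nat.Properties
  using (+-suc; +-comm; +-identityʳ; *-identityˡ; *-identityʳ; m+n∸m≡n;
         ∣n-n∣≡0; ∣m-m+n∣≡n; ∣-∣-comm; m≤n⇒m⊔n≡n; m≥n⇒m⊔n≡m; n≤1+n)
open import Data.Fin using (Fin)
open import Data.Fin.Properties using (_≟_)
open import Data.Vec using (Vec; []; _∷_; head; tail)
open import Data.Vec.Properties using (≡-dec)
open import Data.Vec.Relation.Unary.All using (All; []; _∷_; zip; unzip)
open import Data.Vec.Relation.Unary.Any using (here; there)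
open import Data.Vec.Membership.Propositional using (_∈_; _∉_)
import Data.Vec.Membership.DecPropositional as VecMembership
open import Data.List using (List; []; _∷_; _++_; map; concatMap; filter; length; allFin)
open import Data.List.Properties
  using (length-++; length-tabulate; filter-++; filter-≐; filter-none; filter-accept; filter-reject)
import Data.List.Relation.Unary.All as ListAll
import Data.List.Membership.Propositional as ListMembership
open import Data.List.Relation.Unary.Any using (here; there)
open import Data.List.Relation.Unary.Unique.Propositional using (Unique; _∷_)
open import Data.List.Relation.Unary.Unique.Propositional.Properties using (allFin⁺)
open import Data.List.Membership.Propositional.Properties using (∈-allFin)
open import Data.Product using (_×_; _,_)
open import Data.Sum using (_⊎_; inj₁; inj₂; [_,_]) renaming (map to ⊎-map)
open import Data.Empty using (⊥-elim)
open import Function using (_∘_)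
open import Relation.Nullary using (¬_; yes; no; ¬?; _×-dec_)
open import Relation.Unary using (Pred; Decidable; _⊆_; _≐_; _∪_; ｛_｝; ∁; ∅; _⊥_)
open import Relation.Unary.Properties using (_∪?_; ∁?; ∅?)
open import Relation.Binary.Definitions using (DecidableEquality)
open import Relation.Binary.PropositionalEquality
  using (_≡_; refl; sym; trans; cong; cong₂; subst₂; module ≡-Reasoning)

open ≡-Reasoning

private
  variable
    a b ℓ ℓ₁ ℓ₂ : Level
    A : Set a
    B : Set b
    m n N : ℕ

count : {P : Pred A ℓ} → Decidable P → List A → ℕ
count P? xs = length (filter P? xs)

module _ {P : Pred A ℓ₁} where

  count-≐ : {Q : Pred A ℓ₂} (P? : Decidable P) (Q? : Decidable Q) → P ≐ Q →
            ∀ xs → count P? xs ≡ count Q? xs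
  count-≐ P? Q? P≐Q xs = cong length (filter-≐ P? Q? P≐Q xs)

  count-++ : (P? : Decidable P) (xs ys : List A) →
             count P? (xs ++ ys) ≡ count P? xs + count P? ys
  count-++ P? xs ys = trans (cong length (filter-++ P? xs ys)) (length-++ (filter P? xs))

  count-map : (P? : Decidable P) (f : B → A) (xs : List B) →
              count P? (map f xs) ≡ count (P? ∘ f) xs
  count-map P? f [] = refl
  count-map P? f (x ∷ xs) with P? (f x)
  ... | yes _ = cong suc (count-map P? f xs)
  ... | no _  = count-map P? f xs

  count-none : (P? : Decidable P) {xs : List A} → ListAll.All (∁ P) xs → count P? xs ≡ 0
  count-none P? none = cong length (filter-none P? none)

  count-∁ : (P? : Decidable P) (xs : List A) → count P? xs + count (∁? P?) xs ≡ length xs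
  count-∁ P? [] = refl
  count-∁ P? (x ∷ xs) with P? x
  ... | yes _ = cong suc (count-∁ P? xs)
  ... | no _  = trans (+-suc _ _) (cong suc (count-∁ P? xs))

  count-∪ : {Q : Pred A ℓ₂} (P? : Decidable P) (Q? : Decidable Q) → P ⊥ Q →
            ∀ xs → count (P? ∪? Q?) xs ≡ count P? xs + count Q? xs
  count-∪ P? Q? P⊥Q [] = refl
  count-∪ P? Q? P⊥Q (x ∷ xs) with P? x | Q? x
  ... | yes px | yes qx = ⊥-elim (P⊥Q (px , qx))
  ... | yes _  | no _   = cong suc (count-∪ P? Q? P⊥Q xs)
  ... | no _   | yes _  = trans (cong suc (count-∪ P? Q? P⊥Q xs)) (sym (+-suc _ _))
  ... | no _   | no _   = count-∪ P? Q? P⊥Q xs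

count-unique : (_≟ₐ_ : DecidableEquality A) {x : A} {xs : List A} →
               Unique xs → x ListMembership.∈ xs → count (x ≟ₐ_) xs ≡ 1
count-unique _≟ₐ_ {x} (y≢ys ∷ _) (here refl) =
  trans (cong length (filter-accept (x ≟ₐ_) refl)) (cong suc (count-none (x ≟ₐ_) y≢ys))
count-unique _≟ₐ_ {x} (y≢ys ∷ unique) (there x∈ys) =
  trans (cong length (filter-reject (x ≟ₐ_) λ { refl → ListAll.lookup y≢ys x∈ys refl }))
        (count-unique _≟ₐ_ unique x∈ys)

count-× : {P : Pred A ℓ₁} {Q : Pred (Vec A n) ℓ₂} (P? : Decidable P) (Q? : Decidable Q) →
          (xs : List A) (ys : List (Vec A n)) →
          count (λ v → P? (head v) ×-dec Q? (tail v)) (concatMap (λ b → map (b ∷_) ys) xs)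
            ≡ count P? xs * count Q? ys
count-× P? Q? [] ys = refl
count-× P? Q? (x ∷ xs) ys = begin
  count R? (map (x ∷_) ys ++ concatMap (λ b → map (b ∷_) ys) xs)
    ≡⟨ count-++ R? (map (x ∷_) ys) _ ⟩
  count R? (map (x ∷_) ys) + count R? (concatMap (λ b → map (b ∷_) ys) xs)
    ≡⟨ cong₂ _+_ (count-map R? (x ∷_) ys) (count-× P? Q? xs ys) ⟩
  count (λ t → P? x ×-dec Q? t) ys + count P? xs * count Q? ys
    ≡⟨ row ⟩
  count P? (x ∷ xs) * count Q? ys ∎
  where
  R? = λ v → P? (head v) ×-dec Q? (tail v)
  row : count (λ t → P? x ×-dec Q? t) ys + count P? xs * count Q? ys
          ≡ count P? (x ∷ xs) * count Q? ys
  row with P? x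
  ... | yes px = cong (_+ _) (count-≐ _ Q? ((λ (_ , q) → q) , (px ,_)) ys)
  ... | no ¬px = cong (_+ _) (count-none _ (ListAll.universal (λ _ (px , _) → ¬px px) ys))

data Near : ℕ → ℕ → Set where
  near-refl : Near n n
  near-sucʳ : Near n (suc n)
  near-sucˡ : Near (suc n) n

near-of-increments : m ≡ N ⊎ m ≡ suc N → n ≡ N ⊎ n ≡ suc N → Near m n
near-of-increments (inj₁ refl) (inj₁ refl) = near-refl
near-of-increments (inj₁ refl) (inj₂ refl) = near-sucʳ
near-of-increments (inj₂ refl) (inj₁ refl) = near-sucˡ
near-of-increments (inj₂ refl) (inj₂ refl) = near-refl

module _ {p : ℕ} where

  count-allFin-｛｝ : (i : Fin p) → count (i ≟_) (allFin p) ≡ 1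
  count-allFin-｛｝ i = count-unique _≟_ (allFin⁺ p) (∈-allFin i)

  count-allFin-∁ : {P : Pred (Fin p) ℓ} (P? : Decidable P) →
                   count (∁? P?) (allFin p) ≡ p ∸ count P? (allFin p)
  count-allFin-∁ P? = begin
    count (∁? P?) (allFin p)                 ≡⟨ m+n∸m≡n #P _ ⟨
    #P + count (∁? P?) (allFin p) ∸ #P       ≡⟨ cong (_∸ #P) (count-∁ P? (allFin p)) ⟩
    length (allFin p) ∸ #P                   ≡⟨ cong (_∸ #P) (length-tabulate (λ i → i)) ⟩
    p ∸ #P                                   ∎
    where #P = count P? (allFin p)

  module _ {P : Pred (Fin p) ℓ} (P? : Decidable P) {i : Fin p} where

    count-∪-｛｝-∈ : P i → count (P? ∪? (i ≟_)) (allFin p) ≡ count P? (allFin p)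
    count-∪-｛｝-∈ pi =
      count-≐ (P? ∪? (i ≟_)) P? ([ (λ px → px) , (λ { refl → pi }) ] , inj₁) (allFin p)

    count-∪-｛｝-∉ : ¬ P i → count (P? ∪? (i ≟_)) (allFin p) ≡ suc (count P? (allFin p))
    count-∪-｛｝-∉ ¬pi = begin
      count (P? ∪? (i ≟_)) (allFin p)  ≡⟨ count-∪ P? (i ≟_) (λ { (pi , refl) → ¬pi pi }) (allFin p) ⟩
      #P + count (i ≟_) (allFin p)     ≡⟨ cong (#P +_) (count-allFin-｛｝ i) ⟩
      #P + 1                           ≡⟨ +-comm #P 1 ⟩
      suc #P                           ∎
      where #P = count P? (allFin p)

    count-∪-｛｝ : count (P? ∪? (i ≟_)) (allFin p) ≡ count P? (allFin p)
                 ⊎ count (P? ∪? (i ≟_)) (allFin p) ≡ suc (count P? (allFin p))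
    count-∪-｛｝ with P? i
    ... | yes pi = inj₁ (count-∪-｛｝-∈ pi)
    ... | no ¬pi = inj₂ (count-∪-｛｝-∉ ¬pi)

module _ {p : ℕ} where

  open VecMembership (_≟_ {p}) using (_∈?_)

  private
    variable
      i j : Fin p
      s t : State p n

  ∉⇒All≢ : i ∉ s → All (λ x → ¬ x ≡ i) s
  ∉⇒All≢ {s = []}    _   = []
  ∉⇒All≢ {s = x ∷ s} i∉s = (λ { refl → i∉s (here refl) }) ∷ ∉⇒All≢ (i∉s ∘ there)

  All≢⇒∉ : All (λ x → ¬ x ≡ i) s → i ∉ s
  All≢⇒∉ (x≢i ∷ _)   (here refl) = x≢i refl
  All≢⇒∉ (_   ∷ x≢is) (there i∈s) = All≢⇒∉ x≢is i∈s

  ∈-∷-≐ : (_∈ i ∷ s) ≐ ((_∈ s) ∪ ｛ i ｝)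
  ∈-∷-≐ = (λ { (here refl) → inj₂ refl ; (there x∈s) → inj₁ x∈s })
        , [ there , (λ { refl → here refl }) ]

  occ-[] : occ {p} [] ≡ 0
  occ-[] = count-none (_∈? []) (ListAll.universal (λ _ ()) (allFin p))

  occ-∷-∈ : i ∈ s → occ (i ∷ s) ≡ occ s
  occ-∷-∈ {i} {s = s} i∈s = trans (count-≐ (_∈? i ∷ s) ((_∈? s) ∪? (i ≟_)) ∈-∷-≐ (allFin p))
                                   (count-∪-｛｝-∈ (_∈? s) i∈s)

  occ-∷-∉ : i ∉ s → occ (i ∷ s) ≡ suc (occ s)
  occ-∷-∉ {i} {s = s} i∉s = trans (count-≐ (_∈? i ∷ s) ((_∈? s) ∪? (i ≟_)) ∈-∷-≐ (allFin p))
                                   (count-∪-｛｝-∉ (_∈? s) i∉s)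

  -- Generalised over the pegs P already occupied by the discs of the common prefix.
  count-∪-∈-near : {P : Pred (Fin p) ℓ} (P? : Decidable P) → Adj s t →
                   Near (count (P? ∪? (_∈? s)) (allFin p)) (count (P? ∪? (_∈? t)) (allFin p))
  count-∪-∈-near {s = []} {t = []} P? ()
  count-∪-∈-near {s = i ∷ s} {t = .i ∷ t} {P = P} P? (inj₁ (refl , s~t)) =
    subst₂ Near (count-≐ _ _ prefix-≐ (allFin p)) (count-≐ _ _ prefix-≐ (allFin p))
           (count-∪-∈-near (P? ∪? (i ≟_)) s~t)
    where
    prefix-≐ : ∀ {m} {s : State p m} → ((P ∪ ｛ i ｝) ∪ (_∈ s)) ≐ (P ∪ (_∈ i ∷ s))
    prefix-≐ = (λ { (inj₁ (inj₁ px)) → inj₁ px ; (inj₁ (inj₂ refl)) → inj₂ (here refl)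
                  ; (inj₂ x∈s) → inj₂ (there x∈s) })
             , (λ { (inj₁ px) → inj₁ (inj₁ px) ; (inj₂ (here refl)) → inj₁ (inj₂ refl)
                  ; (inj₂ (there x∈s)) → inj₂ x∈s })
  count-∪-∈-near {s = i ∷ s} {t = j ∷ .s} {P = P} P? (inj₂ (_ , refl , _)) =
    near-of-increments (top-increment i) (top-increment j)
    where
    top-increment : ∀ k → count (P? ∪? (_∈? k ∷ s)) (allFin p) ≡ count (P? ∪? (_∈? s)) (allFin p)
                        ⊎ count (P? ∪? (_∈? k ∷ s)) (allFin p) ≡ suc (count (P? ∪? (_∈? s)) (allFin p))
    top-increment k = ⊎-map (trans top-≐) (trans top-≐) (count-∪-｛｝ (P? ∪? (_∈? s)))
      where
      top-≐ : count (P? ∪? (_∈? k ∷ s)) (allFin p) ≡ count ((P? ∪? (_∈? s)) ∪? (k ≟_)) (allFin p)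
      top-≐ = count-≐ _ _
        ( (λ { (inj₁ px) → inj₁ (inj₁ px) ; (inj₂ (here refl)) → inj₂ refl
             ; (inj₂ (there x∈s)) → inj₁ (inj₂ x∈s) })
        , (λ { (inj₁ (inj₁ px)) → inj₁ px ; (inj₁ (inj₂ x∈s)) → inj₂ (there x∈s)
             ; (inj₂ refl) → inj₂ (here refl) }) )
        (allFin p)

  occ-near : Adj s t → Near (occ s) (occ t)
  occ-near {s = s} {t} s~t =
    subst₂ Near (count-≐ _ _ ∅-∪-≐ (allFin p)) (count-≐ _ _ ∅-∪-≐ (allFin p))
           (count-∪-∈-near ∅? s~t)
    where
    ∅-∪-≐ : ∀ {m} {s : State p m} → (∅ ∪ (_∈ s)) ≐ (_∈ s)
    ∅-∪-≐ = [ (λ ()) , (λ x∈s → x∈s) ] , inj₂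

  Adj-∷-≐ : Adj (i ∷ s) ≐ ((λ v → i ≡ head v × Adj s (tail v))
                           ∪ (λ v → (i ∉ s × head v ∉ i ∷ s) × s ≡ tail v))
  Adj-∷-≐ {i = i} {s = s} = to , from
    where
    to : Adj (i ∷ s) ⊆ _
    to {j ∷ t} (inj₁ same-top) = inj₁ same-top
    to {j ∷ t} (inj₂ (i≢j , refl , avoid)) with unzip avoid
    ... | s≢i , s≢j =
      inj₂ ((All≢⇒∉ s≢i , λ { (here refl) → i≢j refl ; (there j∈s) → All≢⇒∉ s≢j j∈s }) , refl)
    from : _ ⊆ Adj (i ∷ s)
    from {j ∷ t} (inj₁ same-top) = inj₁ same-top
    from {j ∷ t} (inj₂ ((i∉s , j∉is) , refl)) =
      inj₂ ((λ { refl → j∉is (here refl) }) , refl , zip (∉⇒All≢ i∉s , ∉⇒All≢ (j∉is ∘ there)))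

  count-allStates-≡ : (s : State p n) → count (≡-dec _≟_ s) (allStates p n) ≡ 1
  count-allStates-≡ []                  = refl
  count-allStates-≡ {n = suc n} (i ∷ s) = begin
    count (≡-dec _≟_ (i ∷ s)) (allStates p (suc n))
      ≡⟨ count-≐ _ _ ((λ { {_ ∷ _} refl → refl , refl }) , λ { {_ ∷ _} (refl , refl) → refl })
                 (allStates p (suc n)) ⟩
    count (λ v → (i ≟ head v) ×-dec ≡-dec _≟_ s (tail v)) (allStates p (suc n))
      ≡⟨ count-× (i ≟_) (≡-dec _≟_ s) (allFin p) (allStates p n) ⟩
    count (i ≟_) (allFin p) * count (≡-dec _≟_ s) (allStates p n)
      ≡⟨ cong₂ _*_ (count-allFin-｛｝ i) (count-allStates-≡ s) ⟩
    1 ∎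

  -- The new largest disc i can move iff it is alone on its peg, and then to every empty peg.
  bottom-targets? : (i : Fin p) (s : State p n) → Decidable (λ j → i ∉ s × j ∉ i ∷ s)
  bottom-targets? i s j = ¬? (i ∈? s) ×-dec ¬? (j ∈? i ∷ s)

  deg-∷ : (i : Fin p) (s : State p n) → deg (i ∷ s) ≡ deg s + count (bottom-targets? i s) (allFin p)
  deg-∷ {n = n} i s = begin
    deg (i ∷ s)
      ≡⟨ count-≐ (adj? (i ∷ s)) (same-top? ∪? moved-top?) Adj-∷-≐ (allStates p (suc n)) ⟩
    count (same-top? ∪? moved-top?) (allStates p (suc n))
      ≡⟨ count-∪ same-top? moved-top? (λ { ((refl , _) , (_ , j∉is) , _) → j∉is (here refl) })
                 (allStates p (suc n)) ⟩
    count same-top? (allStates p (suc n)) + count moved-top? (allStates p (suc n))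
      ≡⟨ cong₂ _+_ (count-× (i ≟_) (adj? s) (allFin p) (allStates p n))
                   (count-× targets? (≡-dec _≟_ s) (allFin p) (allStates p n)) ⟩
    count (i ≟_) (allFin p) * deg s + count targets? (allFin p) * count (≡-dec _≟_ s) (allStates p n)
      ≡⟨ cong₂ _+_ (cong (_* deg s) (count-allFin-｛｝ i))
                   (cong (count targets? (allFin p) *_) (count-allStates-≡ s)) ⟩
    1 * deg s + count targets? (allFin p) * 1
      ≡⟨ cong₂ _+_ (*-identityˡ (deg s)) (*-identityʳ _) ⟩
    deg s + count targets? (allFin p) ∎
    where
    targets? = bottom-targets? i s
    same-top? = λ v → (i ≟ head v) ×-dec adj? s (tail v)
    moved-top? = λ v → targets? (head v) ×-dec ≡-dec _≟_ s (tail v)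

  count-bottom-targets-∈ : i ∈ s → count (bottom-targets? i s) (allFin p) ≡ 0
  count-bottom-targets-∈ {i} {s = s} i∈s =
    count-none (bottom-targets? i s) (ListAll.universal (λ _ (i∉s , _) → i∉s i∈s) (allFin p))

  count-bottom-targets-∉ : i ∉ s → count (bottom-targets? i s) (allFin p) ≡ p ∸ suc (occ s)
  count-bottom-targets-∉ {i} {s = s} i∉s = begin
    count (bottom-targets? i s) (allFin p)
      ≡⟨ count-≐ _ (∁? (_∈? i ∷ s)) ((λ (_ , j∉is) → j∉is) , (i∉s ,_)) (allFin p) ⟩
    count (∁? (_∈? i ∷ s)) (allFin p)  ≡⟨ count-allFin-∁ (_∈? i ∷ s) ⟩
    p ∸ occ (i ∷ s)                    ≡⟨ cong (p ∸_) (occ-∷-∉ i∉s) ⟩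
    p ∸ suc (occ s)                    ∎

  moves : ℕ → ℕ
  moves zero    = 0
  moves (suc o) = moves o + (p ∸ suc o)

  deg≡moves∘occ : (s : State p n) → deg s ≡ moves (occ s)
  deg≡moves∘occ []      = cong moves (sym occ-[])
  deg≡moves∘occ (i ∷ s) with i ∈? s
  ... | yes i∈s = begin
    deg (i ∷ s)                              ≡⟨ deg-∷ i s ⟩
    deg s + count (bottom-targets? i s) (allFin p)
                                             ≡⟨ cong (deg s +_) (count-bottom-targets-∈ i∈s) ⟩
    deg s + 0                                ≡⟨ +-identityʳ (deg s) ⟩
    deg s                                    ≡⟨ deg≡moves∘occ s ⟩
    moves (occ s)                            ≡⟨ cong moves (occ-∷-∈ i∈s) ⟨
    moves (occ (i ∷ s))                      ∎
  ... | no i∉s = begin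
    deg (i ∷ s)                              ≡⟨ deg-∷ i s ⟩
    deg s + count (bottom-targets? i s) (allFin p)
                                             ≡⟨ cong₂ _+_ (deg≡moves∘occ s) (count-bottom-targets-∉ i∉s) ⟩
    moves (occ s) + (p ∸ suc (occ s))        ≡⟨ cong moves (occ-∷-∉ i∉s) ⟨
    moves (occ (i ∷ s))                      ∎

  moves-near : Near m n → ∣ moves m - moves n ∣ ≡ 0 ⊎ ∣ moves m - moves n ∣ ≡ p ∸ (m ⊔ n)
  moves-near {m} near-refl = inj₁ (∣n-n∣≡0 (moves m))
  moves-near {m} near-sucʳ =
    inj₂ (trans (∣m-m+n∣≡n (moves m) _) (cong (p ∸_) (sym (m≤n⇒m⊔n≡n (n≤1+n m)))))
  moves-near {n = n} near-sucˡ =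
    inj₂ (trans (∣-∣-comm (moves (suc n)) (moves n))
         (trans (∣m-m+n∣≡n (moves n) _) (cong (p ∸_) (sym (m≥n⇒m⊔n≡m (n≤1+n n))))))

mainTheorem6 : (p n : ℕ) → 3 ≤ p → (u v : State p n) → Adj u v →
    (∣ deg u - deg v ∣ ≡ 0) ⊎ (∣ deg u - deg v ∣ ≡ p ∸ (occ u ⊔ occ v))
mainTheorem6 p n _ u v u~v =
  subst₂ (λ du dv → ∣ du - dv ∣ ≡ 0 ⊎ ∣ du - dv ∣ ≡ p ∸ (occ u ⊔ occ v))
         (sym (deg≡moves∘occ u)) (sym (deg≡moves∘occ v))
         (moves-near (occ-near u~v))
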